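{- Let $q\ge2$ and $n\ge1$ be integers. Under scenario $(\circ *)$, the family $\mathcal{G}_q\cup\mathcal{L}_q$ is $n$-cell implementable if and only if $q\le n+1$, where $\mathcal{G}_q=\{x\mapsto[\![x\ge t]\!]\}_{t\in[q\rangle}$ and $\mathcal{L}_q=\{x\mapsto[\![x\le t]\!]\}_{t\in[q\rangle}$.
   Context: $[b\rangle=\{0,1,\ldots,b-1\}$. Let $\mathbb{B}=\{0,1\}$, $\mathbb{B}_\circ=\mathbb{B}$, $\mathbb{B}_*=\mathbb{B}\cup\{*\}$, $\mathbb{B}_\bullet=\mathbb{B}\cup\{*,\bullet\}$. Define $\mathrm{T}:\mathbb{B}_\bullet^2\to\mathbb{B}$ by $\mathrm{T}(u,\vartheta)=1$ if and only if $u=*$, or $\vartheta=*$, or $u=\vartheta\in\mathbb{B}$. $[\![\cdot]\!]$ is the Iverson bracket. $\mathcal{F}_q$ is the set of all functions $[q\rangle\to\mathbb{B}$. For $\alpha,\beta\in\{\circ,*,\bullet\}$, a subset $\Phi\subseteq\mathcal{F}_q$ is $n$-cell implementable under scenario $(\alpha\beta)$ if there exist mappings $\mathbf{u}=(u_j)_{j\in[n\rangle}:[q\rangle\to\mathbb{B}_\alpha^n$ and $\boldsymbol{\vartheta}=(\vartheta_j)_{j\in[n\rangle}:\Phi\to\mathbb{B}_\beta^n$ such that $f(x)=\bigwedge_{j\in[n\rangle}\mathrm{T}(u_j(x),\vartheta_j(f))$ for all $f\in\Phi$ and $x\in[q\rangle$. -}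

module Defs where

open import Data.Nat using (ℕ; _≤ᵇ_)
open import Data.Fin using (Fin; toℕ; zero; suc)
open import Data.Bool using (Bool; true; false; _∧_; if_then_else_)
open import Data.Product using (∃; _×_)
open import Data.Sum using (_⊎_)
open import Relation.Binary.PropositionalEquality using (_≡_)

data 𝔹• : Set where
  bit  : Bool → 𝔹•
  star : 𝔹•
  bul  : 𝔹•

data In𝔹∘ : 𝔹• → Set where
  bitᵢ : ∀ b → In𝔹∘ (bit b)

data In𝔹* : 𝔹• → Set where
  bitᵢ  : ∀ b → In𝔹* (bit b)
  starᵢ : In𝔹* star

T : 𝔹• → 𝔹• → Bool
T star    _       = true
T _       star    = true
T (bit true)  (bit true)  = true
T (bit false) (bit false) = true
T _ _ = false

⋀ : (n : ℕ) → (Fin n → Bool) → Bool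
⋀ ℕ.zero    g = true
⋀ (ℕ.suc n) g = g zero ∧ ⋀ n (λ j → g (suc j))

ℱ : ℕ → Set
ℱ q = Fin q → Bool

Family : ℕ → Set₁
Family q = ℱ q → Set

-- n-cell implementability under scenario (αβ), with the alphabets given as
-- predicates on 𝔹•.  The map ϑ is taken to be defined on all of ℱ_q; only its
-- restriction to Φ matters.
Implementable : (α β : 𝔹• → Set) (q n : ℕ) → Family q → Set
Implementable α β q n Φ =
  ∃ λ (u : Fin q → Fin n → 𝔹•) → ∃ λ (ϑ : ℱ q → Fin n → 𝔹•) →
    (∀ x j → α (u x j)) ×
    (∀ f → Φ f → ∀ j → β (ϑ f j)) ×
    (∀ f → Φ f → ∀ x → f x ≡ ⋀ n (λ j → T (u x j) (ϑ f j)))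

geq : ∀ {q} → Fin q → ℱ q
geq t x = toℕ t ≤ᵇ toℕ x

leq : ∀ {q} → Fin q → ℱ q
leq t x = toℕ x ≤ᵇ toℕ t

GL : (q : ℕ) → Family q
GL q f = (∃ λ (t : Fin q) → ∀ x → f x ≡ geq t x)
       ⊎ (∃ λ (t : Fin q) → ∀ x → f x ≡ leq t x)

{-# OPTIONS --safe #-}
module Submission where

-- Necessity: the threshold function [· ≤ x] vanishes at x + 1, so some cell rejects x + 1
-- while accepting every point of [0, x]; since the keys u_j(z) are bits, that cell takes
-- one value on [0, x] and the other at x + 1.  A cell serving x cannot also serve some
-- y > x (it would be constant on [0, y] ∋ x + 1), so x ↦ cell is injective and q - 1 ≤ n.
-- Sufficiency: the thermometer code u_j(x) = [j < x], with ϑ_j(f) = * unless f changes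
-- between j and j + 1, in which case ϑ_j(f) is the value f(j + 1).  A threshold function
-- changes at most once, and the only non-trivial cell then tests exactly the threshold.

open import Defs
open import Data.Nat
  using (ℕ; zero; suc; _≤_; _<_; _+_; _<ᵇ_; _≤ᵇ_; _<?_; s≤s; s≤s⁻¹)
open import Data.Nat.Properties
  using (≤⇒≤ᵇ; ≤-refl; ≤-reflexive; <⇒≤; <-≤-trans; ≤-trans; m<n⇒m<1+n; ≮⇒≥; +-comm)
open import Data.Fin using (Fin; toℕ; inject₁; fromℕ<)
  renaming (zero to fzero; suc to fsuc; _<_ to _<ᶠ_)
open import Data.Fin.Properties
  using (toℕ-inject₁; toℕ-fromℕ<; toℕ-injective; toℕ<n; injective⇒≤; <-cmp)
  renaming (suc-injective to fsuc-injective)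
open import Data.Bool using (Bool; true; false; not)
open import Data.Bool.Properties using (∧-identityʳ; T-≡)
open import Data.Empty using (⊥; ⊥-elim)
open import Data.Product using (∃; _,_; proj₁; proj₂)
open import Data.Sum using (inj₁; inj₂)
open import Function using (_∘_; case_of_)
open import Function.Bundles using (_⇔_; mk⇔; Equivalence)
open import Relation.Binary using (tri<; tri≈; tri>)
open import Relation.Nullary using (yes; no; ¬_; contradiction)
open import Relation.Binary.PropositionalEquality
  using (_≡_; _≢_; refl; sym; trans; cong; cong₂; subst; module ≡-Reasoning)
open ≡-Reasoning

⋀-true⁻ : ∀ n {g : Fin n → Bool} → ⋀ n g ≡ true → ∀ j → g j ≡ true
⋀-true⁻ (suc n) {g} ⋀≡true j with g fzero in g₀
⋀-true⁻ (suc n) ⋀≡true fzero    | true = g₀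
⋀-true⁻ (suc n) ⋀≡true (fsuc j) | true = ⋀-true⁻ n ⋀≡true j

⋀-false⁻ : ∀ n {g : Fin n → Bool} → ⋀ n g ≡ false → ∃ λ j → g j ≡ false
⋀-false⁻ (suc n) {g} ⋀≡false with g fzero in g₀
... | false = fzero , g₀
... | true  = let j , gj = ⋀-false⁻ n ⋀≡false in fsuc j , gj

⋀-true⁺ : ∀ n {g : Fin n → Bool} → (∀ j → g j ≡ true) → ⋀ n g ≡ true
⋀-true⁺ zero    all = refl
⋀-true⁺ (suc n) all rewrite all fzero = ⋀-true⁺ n (all ∘ fsuc)

⋀-single : ∀ n {g : Fin n → Bool} (c : Fin n) → (∀ j → j ≢ c → g j ≡ true) → ⋀ n g ≡ g c
⋀-single (suc n) {g} fzero others
  rewrite ⋀-true⁺ n (λ j → others (fsuc j) λ ()) = ∧-identityʳ (g fzero)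
⋀-single (suc n) (fsuc c) others
  rewrite others fzero (λ ()) = ⋀-single n c (λ j j≢c → others (fsuc j) (j≢c ∘ fsuc-injective))

≤ᵇ-true : ∀ {m n} → m ≤ n → (m ≤ᵇ n) ≡ true
≤ᵇ-true = Equivalence.to T-≡ ∘ ≤⇒≤ᵇ

<ᵇ-irrefl : ∀ m → (m <ᵇ m) ≡ false
<ᵇ-irrefl zero    = refl
<ᵇ-irrefl (suc m) = <ᵇ-irrefl m

<ᵇ-suc-stable : ∀ m n → n ≢ m → (m <ᵇ n) ≡ (m <ᵇ suc n)
<ᵇ-suc-stable zero    zero    0≢0 = contradiction refl 0≢0
<ᵇ-suc-stable zero    (suc n) _   = refl
<ᵇ-suc-stable (suc m) zero    _   = refl
<ᵇ-suc-stable (suc m) (suc n) n≢m = <ᵇ-suc-stable m n (n≢m ∘ cong suc)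

not-<ᵇ : ∀ m n → not (m <ᵇ n) ≡ (n ≤ᵇ m)
not-<ᵇ m       zero          = refl
not-<ᵇ zero    (suc n)       = refl
not-<ᵇ (suc m) (suc zero)    = refl
not-<ᵇ (suc m) (suc (suc n)) = not-<ᵇ m (suc n)

≤ᵇ-suc-stable : ∀ m n → m ≢ n → (m ≤ᵇ n) ≡ (suc m ≤ᵇ n)
≤ᵇ-suc-stable m n m≢n = begin
  m ≤ᵇ n             ≡⟨ sym (not-<ᵇ n m) ⟩
  not (n <ᵇ m)       ≡⟨ cong not (<ᵇ-suc-stable n m m≢n) ⟩
  not (n <ᵇ suc m)   ≡⟨ not-<ᵇ n (suc m) ⟩
  suc m ≤ᵇ n         ∎

T-bit-true : ∀ b → T (bit b) (bit true) ≡ b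
T-bit-true true  = refl
T-bit-true false = refl

T-bit-false : ∀ b → T (bit b) (bit false) ≡ not b
T-bit-false true  = refl
T-bit-false false = refl

In𝔹∘-two-valued : ∀ {a b c} → In𝔹∘ a → In𝔹∘ b → In𝔹∘ c → a ≢ c → b ≢ c → a ≡ b
In𝔹∘-two-valued (bitᵢ false) (bitᵢ false) _            _   _   = refl
In𝔹∘-two-valued (bitᵢ true)  (bitᵢ true)  _            _   _   = refl
In𝔹∘-two-valued (bitᵢ false) (bitᵢ true)  (bitᵢ false) a≢c _   = contradiction refl a≢c
In𝔹∘-two-valued (bitᵢ false) (bitᵢ true)  (bitᵢ true)  _   b≢c = contradiction refl b≢c
In𝔹∘-two-valued (bitᵢ true)  (bitᵢ false) (bitᵢ true)  a≢c _   = contradiction refl a≢c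
In𝔹∘-two-valued (bitᵢ true)  (bitᵢ false) (bitᵢ false) _   b≢c = contradiction refl b≢c

implementable⇒≤ : ∀ {β p n} {Φ : Family (suc p)} → (∀ t → Φ (leq t)) →
                  Implementable In𝔹∘ β (suc p) n Φ → p ≤ n
implementable⇒≤ {p = p} {n} leq∈Φ (u , ϑ , u∈𝔹∘ , _ , computes) =
  injective⇒≤ separator-injective
  where
  Separates : Fin p → Fin n → Set
  Separates x j = ∀ z → toℕ z ≤ toℕ x → u z j ≢ u (fsuc x) j

  rejecting-cell-separates : ∀ x j → T (u (fsuc x) j) (ϑ (leq (inject₁ x)) j) ≡ false →
                             Separates x j
  rejecting-cell-separates x j rejects z z≤x u≡ = contradiction (begin
      true                                    ≡⟨ sym (⋀-true⁻ n z-accepted j) ⟩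
      T (u z j) (ϑ (leq (inject₁ x)) j)        ≡⟨ cong (λ a → T a (ϑ (leq (inject₁ x)) j)) u≡ ⟩
      T (u (fsuc x) j) (ϑ (leq (inject₁ x)) j) ≡⟨ rejects ⟩
      false                                   ∎) λ ()
    where
    z-accepted : ⋀ n (λ i → T (u z i) (ϑ (leq (inject₁ x)) i)) ≡ true
    z-accepted = trans (sym (computes _ (leq∈Φ _) z))
                    (≤ᵇ-true (subst (toℕ z ≤_) (sym (toℕ-inject₁ x)) z≤x))

  separator : ∀ x → ∃ (Separates x)
  separator x =
    let j , rejects = ⋀-false⁻ n (trans (sym (computes _ (leq∈Φ _) (fsuc x))) x+1∉)
    in j , rejecting-cell-separates x j rejects
    where
    x+1∉ : leq (inject₁ x) (fsuc x) ≡ false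
    x+1∉ = trans (cong (toℕ x <ᵇ_) (toℕ-inject₁ x)) (<ᵇ-irrefl (toℕ x))

  separators-differ : ∀ {x y j} → x <ᶠ y → Separates x j → Separates y j → ⊥
  separators-differ {x} {y} {j} x<y sep-x sep-y =
    sep-x (inject₁ x) (≤-reflexive (toℕ-inject₁ x))
      (In𝔹∘-two-valued (u∈𝔹∘ _ j) (u∈𝔹∘ _ j) (u∈𝔹∘ (fsuc y) j)
        (sep-y (inject₁ x) (subst (_≤ toℕ y) (sym (toℕ-inject₁ x)) (<⇒≤ x<y)))
        (sep-y (fsuc x) x<y))

  separator-injective : ∀ {x y} → proj₁ (separator x) ≡ proj₁ (separator y) → x ≡ y
  separator-injective {x} {y} same with <-cmp x y
  ... | tri< x<y _ _ = ⊥-elim (separators-differ x<y (proj₂ (separator x))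
                                 (subst (Separates y) (sym same) (proj₂ (separator y))))
  ... | tri≈ _ x≡y _ = x≡y
  ... | tri> _ _ y<x = ⊥-elim (separators-differ y<x (proj₂ (separator y))
                                 (subst (Separates x) same (proj₂ (separator x))))

step : Bool → Bool → 𝔹•
step false true  = bit true
step true  false = bit false
step _     _     = star

step-same : ∀ b → step b b ≡ star
step-same true  = refl
step-same false = refl

step-In𝔹* : ∀ a b → In𝔹* (step a b)
step-In𝔹* false false = starᵢ
step-In𝔹* false true  = bitᵢ true
step-In𝔹* true  false = bitᵢ false
step-In𝔹* true  true  = starᵢ

module ThermometerCode {p n : ℕ} (p≤n : p ≤ n) where

  u : Fin (suc p) → Fin n → 𝔹•
  u x j = bit (toℕ j <ᵇ toℕ x)

  ϑ : ℱ (suc p) → Fin n → 𝔹•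
  ϑ f j with toℕ j <? p
  ... | yes j<p = step (f (fromℕ< (m<n⇒m<1+n j<p))) (f (fromℕ< (s≤s j<p)))
  ... | no  _   = star

  ϑ-In𝔹* : ∀ f j → In𝔹* (ϑ f j)
  ϑ-In𝔹* f j with toℕ j <? p
  ... | yes _ = step-In𝔹* _ _
  ... | no  _ = starᵢ

  ϑ-beyond : ∀ f j → ¬ toℕ j < p → ϑ f j ≡ star
  ϑ-beyond f j j≮p with toℕ j <? p
  ... | yes j<p = contradiction j<p j≮p
  ... | no  _   = refl

  accepts : ℱ (suc p) → Fin (suc p) → Bool
  accepts f x = ⋀ n (λ j → T (u x j) (ϑ f j))

  module _ {f : ℱ (suc p)} {g : ℕ → Bool} (f≗g : ∀ x → f x ≡ g (toℕ x)) where

    ϑ-step : ∀ j → toℕ j < p → ϑ f j ≡ step (g (toℕ j)) (g (suc (toℕ j)))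
    ϑ-step j j<p with toℕ j <? p
    ... | yes j<p′ = cong₂ step (f≗g-at (m<n⇒m<1+n j<p′)) (f≗g-at (s≤s j<p′))
      where
      f≗g-at : ∀ {k} (k<q : k < suc p) → f (fromℕ< k<q) ≡ g k
      f≗g-at k<q = trans (f≗g _) (cong g (toℕ-fromℕ< k<q))
    ... | no  j≮p  = contradiction j<p j≮p

    ϑ-flat : ∀ j → (toℕ j < p → g (toℕ j) ≡ g (suc (toℕ j))) → ϑ f j ≡ star
    ϑ-flat j flat = case toℕ j <? p of λ where
      (yes j<p) → trans (ϑ-step j j<p) (trans (cong (step _) (sym (flat j<p))) (step-same _))
      (no  j≮p) → ϑ-beyond f j j≮p

    accepts-flat : (∀ i → i < p → g i ≡ g (suc i)) → ∀ x → accepts f x ≡ true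
    accepts-flat flat x = ⋀-true⁺ n (λ j → cong (T (u x j)) (ϑ-flat j (flat (toℕ j))))

    accepts-jump : ∀ k → k < p → (∀ i → i ≢ k → g i ≡ g (suc i)) →
                   ∀ x → accepts f x ≡ T (bit (k <ᵇ toℕ x)) (step (g k) (g (suc k)))
    accepts-jump k k<p flat x = begin
      accepts f x
        ≡⟨ ⋀-single n c (λ j j≢c → cong (T (u x j)) (ϑ-flat j λ _ → flat (toℕ j) (j≢c ∘ toℕ≡k⇒≡c))) ⟩
      T (u x c) (ϑ f c)
        ≡⟨ cong (T (u x c)) (ϑ-step c (subst (_< p) (sym c≡k) k<p)) ⟩
      T (u x c) (step (g (toℕ c)) (g (suc (toℕ c))))
        ≡⟨ cong (λ i → T (bit (i <ᵇ toℕ x)) (step (g i) (g (suc i)))) c≡k ⟩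
      T (bit (k <ᵇ toℕ x)) (step (g k) (g (suc k)))  ∎
      where
      c : Fin n
      c = fromℕ< (<-≤-trans k<p p≤n)
      c≡k : toℕ c ≡ k
      c≡k = toℕ-fromℕ< _
      toℕ≡k⇒≡c : ∀ {j} → toℕ j ≡ k → j ≡ c
      toℕ≡k⇒≡c j≡k = toℕ-injective (trans j≡k (sym c≡k))

  geq-accepted : ∀ t {f} → (∀ x → f x ≡ geq t x) → ∀ x → f x ≡ accepts f x
  geq-accepted fzero    f≗ x = trans (f≗ x) (sym (accepts-flat f≗ (λ _ _ → refl) x))
  geq-accepted (fsuc c) {f} f≗ x = begin
    f x                                         ≡⟨ f≗ x ⟩
    toℕ c <ᵇ toℕ x                              ≡⟨ sym (T-bit-true _) ⟩
    T (bit (toℕ c <ᵇ toℕ x)) (bit true)          ≡⟨ cong (T _) (sym jump) ⟩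
    T (bit (toℕ c <ᵇ toℕ x)) (step (g k) (g (suc k)))
      ≡⟨ sym (accepts-jump f≗ k (toℕ<n c) (λ i i≢k → <ᵇ-suc-stable k i i≢k) x) ⟩
    accepts f x                                 ∎
    where
    k = toℕ c
    g = suc k ≤ᵇ_
    jump : step (g k) (g (suc k)) ≡ bit true
    jump = cong₂ step (<ᵇ-irrefl k) (≤ᵇ-true (≤-refl {suc k}))

  leq-accepted : ∀ t {f} → (∀ x → f x ≡ leq t x) → ∀ x → f x ≡ accepts f x
  leq-accepted t {f} f≗ x with toℕ t <? p
  ... | yes t<p = begin
    f x                                         ≡⟨ f≗ x ⟩
    toℕ x ≤ᵇ k                                  ≡⟨ sym (not-<ᵇ k (toℕ x)) ⟩
    not (k <ᵇ toℕ x)                             ≡⟨ sym (T-bit-false _) ⟩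
    T (bit (k <ᵇ toℕ x)) (bit false)             ≡⟨ cong (T _) (sym jump) ⟩
    T (bit (k <ᵇ toℕ x)) (step (g k) (g (suc k)))
      ≡⟨ sym (accepts-jump f≗ k t<p (λ i i≢k → ≤ᵇ-suc-stable i k i≢k) x) ⟩
    accepts f x                                 ∎
    where
    k = toℕ t
    g = _≤ᵇ k
    jump : step (g k) (g (suc k)) ≡ bit false
    jump = cong₂ step (≤ᵇ-true (≤-refl {k})) (<ᵇ-irrefl k)
  ... | no t≮p = trans (f≗ x) (trans (≤ᵇ-true x≤t) (sym (accepts-flat f≗ flat x)))
    where
    x≤t : toℕ x ≤ toℕ t
    x≤t = ≤-trans (s≤s⁻¹ (toℕ<n x)) (≮⇒≥ t≮p)
    flat : ∀ i → i < p → (i ≤ᵇ toℕ t) ≡ (suc i ≤ᵇ toℕ t)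
    flat i i<p = ≤ᵇ-suc-stable i (toℕ t) (λ { refl → t≮p i<p })

  implements : Implementable In𝔹∘ In𝔹* (suc p) n (GL (suc p))
  implements = u , ϑ , (λ _ _ → bitᵢ _) , (λ f _ → ϑ-In𝔹* f) , λ where
    f (inj₁ (t , f≗geq)) → geq-accepted t f≗geq
    f (inj₂ (t , f≗leq)) → leq-accepted t f≗leq

proposition12 : (q n : ℕ) → 2 ≤ q → 1 ≤ n →
    (Implementable In𝔹∘ In𝔹* q n (GL q) ⇔ q ≤ n + 1)
proposition12 (suc p) n _ _ = mk⇔
  (λ impl → subst (suc p ≤_) (+-comm 1 n)
              (s≤s (implementable⇒≤ {In𝔹*} (λ t → inj₂ (t , λ _ → refl)) impl)))
  (λ q≤n+1 → ThermometerCode.implements (s≤s⁻¹ (subst (suc p ≤_) (+-comm n 1) q≤n+1)))
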